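{- Let $\ell\equiv 3\pmod 8$ with $\ell\ge 11$. There is an $\ell$-cycle $C$ on vertex set $\mathbb{Z}_{2\ell}\times\{0,1\}$ whose edges consist of $(\ell-3)/2$ edges with pairwise distinct $0$-pure differences, $(\ell-1)/2$ edges with pairwise distinct $1$-pure differences, and two edges of mixed differences $0$ and $\ell$, such that: (1) $C$ has no edge of $0$-pure difference $\pm 2$, $\pm(\ell-5)/2$ or $\ell$, and no edge of $1$-pure difference $\pm(\ell-5)/2$ or $\ell$; (2) for every vertex $x_0$ of $C$, $x_1$ is also a vertex of $C$; in particular $C$ and all its translates $C+t$, $t\in\mathbb{Z}_{2\ell}$, are equitably coloured under the colouring described below.
   Context: Write $a_i$ for the vertex $(a,i)\in \mathbb{Z}_{2\ell}\times\{0,1\}$. An edge $a_0 b_1$ has mixed difference $b-a \pmod{2\ell}$; an edge $a_i b_i$ has $i$-pure difference $\pm(b-a)\pmod{2\ell}$. For $t\in\mathbb{Z}_{2\ell}$, $C+t$ is obtained by replacing each vertex $a_i$ with $(a+t)_i$. The colouring: $a_0$ is red if $a\in\{0,\dots,\ell-1\}$ and blue otherwise; $a_1$ is blue if $a\in\{0,\dots,\ell-1\}$ and red otherwise. An $\ell$-cycle is equitably coloured if it contains $(\ell-1)/2$ or $(\ell+1)/2$ red vertices. -}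

module Defs where

open import Data.Nat using (ℕ; zero; suc; _+_; _*_; _∸_; _≤ᵇ_; _<ᵇ_; _⊓_; s≤s)
open import Data.Nat.Properties using (_≟_; ≤∧≢⇒<)
open import Data.Bool using (Bool; true; false; if_then_else_; not)
open import Data.Fin using (Fin; zero; suc; toℕ; fromℕ<)
open import Data.Fin.Properties using (toℕ<n)
open import Data.Product using (_×_; _,_)
open import Relation.Nullary using (yes; no)

-- Vertices of Z_{2ℓ} × {0,1}: a_i is (a , i) with a : Fin (2ℓ), i : Fin 2.
Vtx : ℕ → Set
Vtx ℓ = Fin (2 * ℓ) × Fin 2

next : ∀ {n} → Fin n → Fin n
next {suc m} i with toℕ i ≟ m
... | yes _ = zero
... | no ne = fromℕ< {suc (toℕ i)} (s≤s (≤∧≢⇒< (Data.Nat.Properties.≤-pred (toℕ<n i)) ne))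

subMod : ℕ → ℕ → ℕ → ℕ
subMod n a b = if a ≤ᵇ b then b ∸ a else (n + b) ∸ a

-- canonical representative in {0,…,n/2} of the class ±d mod n
pmRep : ℕ → ℕ → ℕ
pmRep n d = d ⊓ (n ∸ d)

-- Kinds of edges together with their differences.
-- Pure differences are recorded by the canonical representative of ±d
-- (an element of {0,…,ℓ}); mixed difference of a_0 b_1 is b - a mod 2ℓ.
data Kind : Set where
  pure0 : ℕ → Kind
  pure1 : ℕ → Kind
  mixed : ℕ → Kind

kind : (ℓ : ℕ) → Vtx ℓ → Vtx ℓ → Kind
kind ℓ (a , zero)     (b , zero)     = pure0 (pmRep (2 * ℓ) (subMod (2 * ℓ) (toℕ a) (toℕ b)))
kind ℓ (a , suc zero) (b , suc zero) = pure1 (pmRep (2 * ℓ) (subMod (2 * ℓ) (toℕ a) (toℕ b)))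
kind ℓ (a , zero)     (b , suc zero) = mixed (subMod (2 * ℓ) (toℕ a) (toℕ b))
kind ℓ (a , suc zero) (b , zero)     = mixed (subMod (2 * ℓ) (toℕ b) (toℕ a))

is0pure : Kind → Bool
is0pure (pure0 _) = true
is0pure _ = false

is1pure : Kind → Bool
is1pure (pure1 _) = true
is1pure _ = false

countF : ∀ {n} → (Fin n → Bool) → ℕ
countF {zero} p = 0
countF {suc n} p = (if p zero then 1 else 0) + countF {n} (λ i → p (suc i))

edgeKind : (ℓ : ℕ) → (Fin ℓ → Vtx ℓ) → Fin ℓ → Kind
edgeKind ℓ C i = kind ℓ (C i) (C (next i))

shiftVal : ℕ → ℕ → ℕ → ℕ
shiftVal ℓ a t = if (a + t) <ᵇ (2 * ℓ) then a + t else (a + t) ∸ (2 * ℓ)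

isRed : ℕ → ℕ → Fin 2 → Bool
isRed ℓ x zero = x <ᵇ ℓ
isRed ℓ x (suc zero) = not (x <ᵇ ℓ)

redCount : (ℓ : ℕ) → (Fin ℓ → Vtx ℓ) → Fin (2 * ℓ) → ℕ
redCount ℓ C t = countF {ℓ} (λ k → vRed (C k))
  where
  vRed : Vtx ℓ → Bool
  vRed (a , i) = isRed ℓ (shiftVal ℓ (toℕ a) (toℕ t)) i

-- For ℓ = 4m + 3 with m ≥ 2 (so only ℓ ≡ 3 mod 4 and ℓ ≥ 11 are used) take the ℓ-cycle
--
--   ℓ₁ (4m−1)₁ 0₁ (4m−2)₁ 1₁ … (3m)₁ (m−1)₁ m₁ m₀ (3m)₀ (m−1)₀ (3m+1)₀ … 1₀ (4m−1)₀ 0₀.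
--
-- On level 1 a falling and a rising run are interleaved and approach each other, so the pure
-- differences there are 4m−1, 4m−2, …, 2m+1, together with 4 on ℓ₁(4m−1)₁ and 1 on (m−1)₁m₁.
-- On level 0 the two runs move apart and the differences are 2m, 2m+1, …, 4m−1. All of them are
-- at most ℓ, hence their own representatives of ±d, and none is 2, (ℓ−5)/2 = 2m−1 or ℓ. The edges
-- m₁m₀ and 0₀ℓ₁ have mixed differences 0 and ℓ. Apart from ℓ₁ both levels carry the same values,
-- and a₀, a₁ receive opposite colours under every translation, so each translate has 2m+1 red
-- vertices besides possibly ℓ₁.

{-# OPTIONS --safe #-}
module Submission where

open import Defs
open import Data.Bool using (Bool; true; false; if_then_else_; not; T)
open import Data.Empty using (⊥-elim)
open import Data.Fin using (Fin; zero; suc; toℕ; fromℕ<)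
open import Data.Fin.Properties using (toℕ-fromℕ<; toℕ-injective; toℕ<n)
open import Data.List using (_∷_; [])
open import Data.Nat
  using (ℕ; zero; suc; _+_; _*_; _∸_; _≤_; _<_; _≤ᵇ_; _<ᵇ_; _/_; _%_; _⊓_; ∣_-_∣; z≤n; s≤s; z<s; s<s)
open import Data.Nat.DivMod using (_mod_; m*n/n≡m; m<n⇒m%n≡m; m≡m%n+[m/n]*n)
open import Data.Nat.Properties
open import Data.Nat.Tactic.RingSolver using (solve; solve-∀)
open import Data.Product using (Σ-syntax; ∃; ∃-syntax; _×_; _,_; proj₁; proj₂)
open import Data.Sum using (_⊎_; inj₁; inj₂) renaming (map to ⊎-map)
open import Data.Unit using (tt)
open import Function using (_∘_; _∋_; id; const)
open import Function.Definitions using (Injective)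
open import Relation.Binary.Definitions using (tri<; tri≈; tri>)
open import Relation.Binary.PropositionalEquality
open import Relation.Nullary using (yes; no)

open ≡-Reasoning

1+2*m<2*n : ∀ {m n} → m < n → suc (2 * m) < 2 * n
1+2*m<2*n {m} {n} m<n = subst (_≤ 2 * n) (cong suc (+-suc m (m + 0))) (*-monoʳ-≤ 2 m<n)

m+o≡n⇒m≤n : ∀ {m n} o → m + o ≡ n → m ≤ n
m+o≡n⇒m≤n {m} o refl = m≤m+n m o

m+o≡n⇒∣m-n∣≡o : ∀ {m n o} → m + o ≡ n → ∣ m - n ∣ ≡ o
m+o≡n⇒∣m-n∣≡o {m} {o = o} refl = ∣m-m+n∣≡n m o

n+o≡m⇒∣m-n∣≡o : ∀ {m n o} → n + o ≡ m → ∣ m - n ∣ ≡ o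
n+o≡m⇒∣m-n∣≡o {m} {n} n+o≡m = trans (∣-∣-comm m n) (m+o≡n⇒∣m-n∣≡o n+o≡m)

m≡n*2⇒m/2≡n : ∀ {m n} → m ≡ n * 2 → m / 2 ≡ n
m≡n*2⇒m/2≡n {n = n} refl = m*n/n≡m n 2

if-true : ∀ {A : Set} {b} {x y : A} → b ≡ true → (if b then x else y) ≡ x
if-true refl = refl

if-false : ∀ {A : Set} {b} {x y : A} → b ≡ false → (if b then x else y) ≡ y
if-false refl = refl

<ᵇ-true : ∀ {m n} → m < n → (m <ᵇ n) ≡ true
<ᵇ-true {m} {n} m<n with m <ᵇ n | <⇒<ᵇ m<n
... | true | _ = refl

<ᵇ-false : ∀ {m n} → n ≤ m → (m <ᵇ n) ≡ false
<ᵇ-false {m} {n} n≤m with m <ᵇ n in m<ᵇn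
... | false = refl
... | true  = ⊥-elim (<⇒≱ (<ᵇ⇒< m n (subst T (sym m<ᵇn) tt)) n≤m)

-- Sequences assembled from blocks and zigzags

infixr 5 _++[_]_

_++[_]_ : {A : Set} → (ℕ → A) → ℕ → (ℕ → A) → ℕ → A
(f ++[ zero  ] g) p       = g p
(f ++[ suc k ] g) zero    = f zero
(f ++[ suc k ] g) (suc p) = ((f ∘ suc) ++[ k ] g) p

++-left : ∀ {A : Set} {f g : ℕ → A} {k p} → p < k → (f ++[ k ] g) p ≡ f p
++-left {k = suc k} {zero}  _         = refl
++-left {k = suc k} {suc p} (s<s p<k) = ++-left p<k

++-right : ∀ {A : Set} {f g : ℕ → A} k q → (f ++[ k ] g) (k + q) ≡ g q
++-right zero    q = refl
++-right (suc k) q = ++-right k q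

zigzag : {A : Set} → (ℕ → A) → (ℕ → A) → ℕ → A
zigzag f g zero    = f zero
zigzag f g (suc p) = zigzag g (f ∘ suc) p

zigzag-even : ∀ {A : Set} (f g : ℕ → A) j → zigzag f g (2 * j) ≡ f j
zigzag-even f g zero    = refl
zigzag-even f g (suc j) =
  trans (cong (zigzag g (f ∘ suc)) (+-suc j (j + 0))) (zigzag-even (f ∘ suc) (g ∘ suc) j)

zigzag-odd : ∀ {A : Set} (f g : ℕ → A) j → zigzag f g (suc (2 * j)) ≡ g j
zigzag-odd f g = zigzag-even g (f ∘ suc)

data EvenOrOdd : ℕ → Set where
  even : ∀ j → EvenOrOdd (2 * j)
  odd  : ∀ j → EvenOrOdd (suc (2 * j))

evenOrOdd : ∀ n → EvenOrOdd n
evenOrOdd zero = even 0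
evenOrOdd (suc n) with evenOrOdd n
... | even j = odd j
... | odd j  = subst EvenOrOdd (cong suc (+-suc j (j + 0))) (even (suc j))

diverging-gap : ∀ {a b g q} → a + g ≡ b → q < 2 * a →
  ∣ zigzag (a ∸_) (b +_) q - zigzag (a ∸_) (b +_) (suc q) ∣ ≡ g + q
diverging-gap {a} {b} {g} {q} a+g≡b q<2a with evenOrOdd q
... | even j = begin
  ∣ zigzag (a ∸_) (b +_) (2 * j) - zigzag (a ∸_) (b +_) (suc (2 * j)) ∣
    ≡⟨ cong₂ ∣_-_∣ (zigzag-even (a ∸_) (b +_) j) (zigzag-odd (a ∸_) (b +_) j) ⟩
  ∣ a ∸ j - b + j ∣
    ≡⟨ m+o≡n⇒∣m-n∣≡o {a ∸ j} (begin
         a ∸ j + (g + 2 * j)  ≡⟨ shuffle (a ∸ j) g j ⟩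
         a ∸ j + j + g + j    ≡⟨ cong (λ x → x + g + j) (m∸n+n≡m (<⇒≤ (*-cancelˡ-< 2 j a q<2a))) ⟩
         a + g + j            ≡⟨ cong (_+ j) a+g≡b ⟩
         b + j                ∎) ⟩
  g + 2 * j ∎
  where
  shuffle : ∀ x g j → x + (g + 2 * j) ≡ x + j + g + j
  shuffle = solve-∀
... | odd j = begin
  ∣ zigzag (a ∸_) (b +_) (suc (2 * j)) - zigzag (a ∸_) (b +_) (suc (suc (2 * j))) ∣
    ≡⟨ cong₂ ∣_-_∣ (zigzag-odd (a ∸_) (b +_) j)
                   (zigzag-even (λ s → a ∸ suc s) (λ s → b + suc s) j) ⟩
  ∣ b + j - a ∸ suc j ∣
    ≡⟨ n+o≡m⇒∣m-n∣≡o {n = a ∸ suc j} (begin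
         a ∸ suc j + (g + suc (2 * j))  ≡⟨ shuffle (a ∸ suc j) g j ⟩
         a ∸ suc j + suc j + g + j      ≡⟨ cong (λ x → x + g + j) (m∸n+n≡m j<a) ⟩
         a + g + j                      ≡⟨ cong (_+ j) a+g≡b ⟩
         b + j                          ∎) ⟩
  g + suc (2 * j) ∎
  where
  j<a : j < a
  j<a = *-cancelˡ-< 2 j a (<-trans (n<1+n _) q<2a)
  shuffle : ∀ x g j → x + (g + suc (2 * j)) ≡ x + suc j + g + j
  shuffle = solve-∀

converging-gap : ∀ {c q d} → q + d ≡ c →
  ∣ zigzag (c ∸_) id q - zigzag (c ∸_) id (suc q) ∣ ≡ d
converging-gap {c} {q} {d} q+d≡c with evenOrOdd q
... | even j = begin
  ∣ zigzag (c ∸_) id (2 * j) - zigzag (c ∸_) id (suc (2 * j)) ∣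
    ≡⟨ cong₂ ∣_-_∣ (zigzag-even (c ∸_) id j) (zigzag-odd (c ∸_) id j) ⟩
  ∣ c ∸ j - j ∣
    ≡⟨ n+o≡m⇒∣m-n∣≡o (sym (trans (cong (_∸ j) c≡) (m+n∸m≡n j (j + d)))) ⟩
  d ∎
  where
  regroup : ∀ j d → 2 * j + d ≡ j + (j + d)
  regroup = solve-∀
  c≡ : c ≡ j + (j + d)
  c≡ = trans (sym q+d≡c) (regroup j d)
... | odd j = begin
  ∣ zigzag (c ∸_) id (suc (2 * j)) - zigzag (c ∸_) id (suc (suc (2 * j))) ∣
    ≡⟨ cong₂ ∣_-_∣ (zigzag-odd (c ∸_) id j) (zigzag-even (λ s → c ∸ suc s) suc j) ⟩
  ∣ j - c ∸ suc j ∣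
    ≡⟨ m+o≡n⇒∣m-n∣≡o (sym (trans (cong (_∸ suc j) c≡) (m+n∸m≡n (suc j) (j + d)))) ⟩
  d ∎
  where
  regroup : ∀ j d → suc (2 * j) + d ≡ suc j + (j + d)
  regroup = solve-∀
  c≡ : c ≡ suc j + (j + d)
  c≡ = trans (sym q+d≡c) (regroup j d)

bit : Bool → ℕ
bit b = if b then 1 else 0

count : ℕ → (ℕ → Bool) → ℕ
count k h = countF {k} (λ i → h (toℕ i))

countF-cong : ∀ {n} {f g : Fin n → Bool} → (∀ i → f i ≡ g i) → countF f ≡ countF g
countF-cong {zero}  _   = refl
countF-cong {suc n} f≗g = cong₂ _+_ (cong bit (f≗g zero)) (countF-cong (f≗g ∘ suc))

count-cong : ∀ {k} {h h′ : ℕ → Bool} → (∀ {p} → p < k → h p ≡ h′ p) → count k h ≡ count k h′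
count-cong h≗h′ = countF-cong (λ i → h≗h′ (toℕ<n i))

count-true : ∀ {k} {h : ℕ → Bool} → (∀ {p} → p < k → h p ≡ true) → count k h ≡ k
count-true {zero}  _      = refl
count-true {suc k} h≡true = cong₂ _+_ (cong bit (h≡true z<s)) (count-true (λ p<k → h≡true (s<s p<k)))

count-false : ∀ {k} {h : ℕ → Bool} → (∀ {p} → p < k → h p ≡ false) → count k h ≡ 0
count-false {zero}  _       = refl
count-false {suc k} h≡false = cong₂ _+_ (cong bit (h≡false z<s)) (count-false (λ p<k → h≡false (s<s p<k)))

count-+ : ∀ k {k′} (h : ℕ → Bool) → count (k + k′) h ≡ count k h + count k′ (λ q → h (k + q))
count-+ zero    h = refl
count-+ (suc k) h =
  trans (cong (bit (h 0) +_) (count-+ k (h ∘ suc))) (sym (+-assoc (bit (h 0)) (count k (h ∘ suc)) _))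

count-snoc : ∀ k (h : ℕ → Bool) → count (suc k) h ≡ count k h + bit (h k)
count-snoc zero    h = +-identityʳ _
count-snoc (suc k) h =
  trans (cong (bit (h 0) +_) (count-snoc k (h ∘ suc))) (sym (+-assoc (bit (h 0)) (count k (h ∘ suc)) _))

count-reverse : ∀ k (h : ℕ → Bool) → count k (λ j → h (k ∸ suc j)) ≡ count k h
count-reverse zero    h = refl
count-reverse (suc k) h = begin
  bit (h k) + count k (λ j → h (k ∸ suc j)) ≡⟨ cong (bit (h k) +_) (count-reverse k h) ⟩
  bit (h k) + count k h                     ≡⟨ +-comm (bit (h k)) _ ⟩
  count k h + bit (h k)                     ≡⟨ count-snoc k h ⟨
  count (suc k) h                           ∎

count-complement : ∀ k (h : ℕ → Bool) → count k (not ∘ h) + count k h ≡ k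
count-complement zero    h = refl
count-complement (suc k) h with h 0 | count-complement k (h ∘ suc)
... | true  | sum≡k = trans (+-suc _ _) (cong suc sum≡k)
... | false | sum≡k = cong suc sum≡k

count-zigzag : ∀ {A : Set} k (h : A → Bool) (f g : ℕ → A) →
  count (2 * k) (λ p → h (zigzag f g p)) ≡ count k (h ∘ f) + count k (h ∘ g)
count-zigzag zero    h f g = refl
count-zigzag (suc k) h f g = begin
  count (2 * suc k) (λ p → h (zigzag f g p))
    ≡⟨ cong (λ n → count n (λ p → h (zigzag f g p))) (cong suc (+-suc k (k + 0))) ⟩
  bit (h (f 0)) + (bit (h (g 0)) + count (2 * k) (λ p → h (zigzag (f ∘ suc) (g ∘ suc) p)))
    ≡⟨ cong (λ n → bit (h (f 0)) + (bit (h (g 0)) + n)) (count-zigzag k h (f ∘ suc) (g ∘ suc)) ⟩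
  bit (h (f 0)) + (bit (h (g 0)) + (count k (h ∘ f ∘ suc) + count k (h ∘ g ∘ suc)))
    ≡⟨ interchange (bit (h (f 0))) (bit (h (g 0))) _ _ ⟩
  count (suc k) (h ∘ f) + count (suc k) (h ∘ g) ∎
  where
  interchange : ∀ a b x y → a + (b + (x + y)) ≡ (a + x) + (b + y)
  interchange = solve-∀

-- Differences modulo N and the cyclic successor

subMod-≤ : ∀ N {x y} → x ≤ y → subMod N x y ≡ y ∸ x
subMod-≤ N {x} {y} x≤y with x ≤ᵇ y | ≤⇒≤ᵇ x≤y
... | true | _ = refl

subMod-> : ∀ N {x y} → y < x → subMod N x y ≡ (N + y) ∸ x
subMod-> N {x} {y} y<x with x ≤ᵇ y in x≤ᵇy
... | false = refl
... | true  = ⊥-elim (<⇒≱ y<x (≤ᵇ⇒≤ x y (subst T (sym x≤ᵇy) tt)))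

pmRep-≤ : ∀ {N d} → d + d ≤ N → pmRep N d ≡ d
pmRep-≤ {d = d} 2d≤N = m≤n⇒m⊓n≡m (m+n≤o⇒m≤o∸n d 2d≤N)

pmRep-∸ : ∀ {N d} → d + d ≤ N → pmRep N (N ∸ d) ≡ d
pmRep-∸ {N} {d} 2d≤N =
  trans (cong ((N ∸ d) ⊓_) (m∸[m∸n]≡n (≤-trans (m≤m+n d d) 2d≤N)))
        (m≥n⇒m⊓n≡n (m+n≤o⇒m≤o∸n d 2d≤N))

pmRep-subMod : ∀ N x y → ∣ x - y ∣ + ∣ x - y ∣ ≤ N → pmRep N (subMod N x y) ≡ ∣ x - y ∣
pmRep-subMod N x y 2d≤N with x ≤? y
... | yes x≤y = begin
  pmRep N (subMod N x y) ≡⟨ cong (pmRep N) (trans (subMod-≤ N x≤y) (sym (m≤n⇒∣m-n∣≡n∸m x≤y))) ⟩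
  pmRep N ∣ x - y ∣      ≡⟨ pmRep-≤ 2d≤N ⟩
  ∣ x - y ∣              ∎
... | no x≰y = begin
  pmRep N (subMod N x y)             ≡⟨ cong (pmRep N) (subMod-> N y<x) ⟩
  pmRep N ((N + y) ∸ x)              ≡⟨ cong (pmRep N) (cong₂ _∸_ (+-comm N y) (sym (m+[n∸m]≡n (<⇒≤ y<x)))) ⟩
  pmRep N ((y + N) ∸ (y + (x ∸ y)))  ≡⟨ cong (pmRep N) ([m+n]∸[m+o]≡n∸o y N (x ∸ y)) ⟩
  pmRep N (N ∸ (x ∸ y))              ≡⟨ cong (λ d → pmRep N (N ∸ d)) (sym (m≤n⇒∣n-m∣≡n∸m (<⇒≤ y<x))) ⟩
  pmRep N (N ∸ ∣ x - y ∣)            ≡⟨ pmRep-∸ 2d≤N ⟩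
  ∣ x - y ∣                          ∎
  where
  y<x : y < x
  y<x = ≰⇒> x≰y

next-periodic : ∀ {A : Set} {n} (s : ℕ → A) → s n ≡ s 0 → (i : Fin n) →
  s (toℕ (next i)) ≡ s (suc (toℕ i))
next-periodic {n = suc k} s sn≡s0 i with toℕ i ≟ k
... | yes i≡k = trans (sym sn≡s0) (cong (s ∘ suc) (sym i≡k))
... | no  i≢k = cong s (toℕ-fromℕ< (s≤s (≤∧≢⇒< (≤-pred (toℕ<n i)) i≢k)))

-- The cycle for ℓ = 4m + 3

module Cycle (m : ℕ) (2≤m : 2 ≤ m) where

  ℓ : ℕ
  ℓ = 3 + 4 * m

  N : ℕ
  N = 2 * ℓ

  c : ℕ
  c = 4 * m ∸ 1

  4≤2m : 4 ≤ 2 * m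
  4≤2m = *-monoʳ-≤ 2 2≤m

  0<2m : 0 < 2 * m
  0<2m = ≤-trans (s≤s z≤n) 4≤2m

  2m+2m≡4m : 2 * m + 2 * m ≡ 4 * m
  2m+2m≡4m = solve (m ∷ [])

  1+c≡4m : suc c ≡ 4 * m
  1+c≡4m = trans (+-comm 1 c) (m∸n+n≡m (≤-trans (≤-trans (s≤s z≤n) 2≤m) (m≤m+n m (3 * m))))

  2m≤c : 2 * m ≤ c
  2m≤c = ≤-pred (subst (suc (2 * m) ≤_) (sym 1+c≡4m)
                       (subst (2 * m <_) 2m+2m≡4m (m<m+n (2 * m) 0<2m)))

  m<ℓ : m < ℓ
  m<ℓ = m+o≡n⇒m≤n (2 + 3 * m) (suc m + (2 + 3 * m) ≡ 3 + 4 * m ∋ solve (m ∷ []))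

  1+2m<ℓ : suc (2 * m) < ℓ
  1+2m<ℓ = m+o≡n⇒m≤n (1 + 2 * m) (suc (suc (2 * m)) + (1 + 2 * m) ≡ 3 + 4 * m ∋ solve (m ∷ []))

  2m<ℓ : 2 * m < ℓ
  2m<ℓ = <-trans (n<1+n (2 * m)) 1+2m<ℓ

  4m<ℓ : 4 * m < ℓ
  4m<ℓ = m+o≡n⇒m≤n 2 (suc (4 * m) + 2 ≡ 3 + 4 * m ∋ solve (m ∷ []))

  c<ℓ : c < ℓ
  c<ℓ = ≤-<-trans (m∸n≤m (4 * m) 1) 4m<ℓ

  [ℓ∸1]/2≡1+2m : (ℓ ∸ 1) / 2 ≡ suc (2 * m)
  [ℓ∸1]/2≡1+2m = m≡n*2⇒m/2≡n (2 + 4 * m ≡ suc (2 * m) * 2 ∋ solve (m ∷ []))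

  level₀-offset-≤ : ∀ {r} → 2 + 2 * m + r < ℓ → r ≤ 2 * m
  level₀-offset-≤ {r} p<ℓ = +-cancelˡ-≤ (2 * m) r (2 * m)
    (subst (2 * m + r ≤_) (sym 2m+2m≡4m) (≤-pred (≤-pred (≤-pred p<ℓ))))

  level₀-position-< : ∀ {q} → q ≤ 2 * m → 2 + 2 * m + q < ℓ
  level₀-position-< {q} q≤2m =
    ≤-trans (+-monoʳ-≤ (3 + 2 * m) q≤2m) (≤-reflexive (3 + 2 * m + 2 * m ≡ 3 + 4 * m ∋ solve (m ∷ [])))

  level₁ : ℕ → ℕ
  level₁ = zigzag (c ∸_) id

  level₀ : ℕ → ℕ
  level₀ = zigzag (m ∸_) (3 * m +_)

  -- Position ℓ repeats position 0, so the closing edge is the step from ℓ − 1 to ℓ.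
  vertexAt : ℕ → ℕ × Fin 2
  vertexAt = const (ℓ , suc zero)
    ++[ 1 ]         (λ q → level₁ q , suc zero)
    ++[ 2 * m ]     const (m , suc zero)
    ++[ 1 ]         (λ q → level₀ q , zero)
    ++[ 1 + 2 * m ] const (ℓ , suc zero)

  vertexAt-level₁ : ∀ {q} → q < 2 * m → vertexAt (suc q) ≡ (level₁ q , suc zero)
  vertexAt-level₁ = ++-left

  vertexAt-mid : vertexAt (suc (2 * m)) ≡ (m , suc zero)
  vertexAt-mid = trans (cong (vertexAt ∘ suc) (sym (+-identityʳ (2 * m)))) (++-right (2 * m) 0)

  vertexAt-level₀ : ∀ {q} → q ≤ 2 * m → vertexAt (2 + 2 * m + q) ≡ (level₀ q , zero)
  vertexAt-level₀ {q} q≤2m =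
    trans (cong (vertexAt ∘ suc) (sym (+-suc (2 * m) q)))
          (trans (++-right (2 * m) (suc q)) (++-left (s≤s q≤2m)))

  vertexAt-ℓ : vertexAt ℓ ≡ (ℓ , suc zero)
  vertexAt-ℓ =
    trans (cong (vertexAt ∘ suc) (suc (suc (4 * m)) ≡ 2 * m + suc (suc (2 * m + 0)) ∋ solve (m ∷ [])))
          (trans (++-right (2 * m) (suc (suc (2 * m + 0)))) (++-right (2 * m) 0))

  data CycleVertex : ℕ → ℕ × Fin 2 → Set where
    top   : CycleVertex 0 (ℓ , suc zero)
    high₁ : ∀ {j} → j < m → CycleVertex (suc (2 * j)) (c ∸ j , suc zero)
    low₁  : ∀ {j} → j < m → CycleVertex (2 + 2 * j) (j , suc zero)
    mid   : CycleVertex (suc (2 * m)) (m , suc zero)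
    low₀  : ∀ {s} → s ≤ m → CycleVertex (2 + 2 * m + 2 * s) (m ∸ s , zero)
    high₀ : ∀ {s} → s < m → CycleVertex (2 + 2 * m + suc (2 * s)) (3 * m + s , zero)

  CycleVertex⇒vertexAt : ∀ {p v} → CycleVertex p v → vertexAt p ≡ v
  CycleVertex⇒vertexAt top             = refl
  CycleVertex⇒vertexAt (high₁ {j} j<m) =
    trans (vertexAt-level₁ (<-trans (n<1+n _) (1+2*m<2*n j<m)))
          (cong (_, suc zero) (zigzag-even (c ∸_) id j))
  CycleVertex⇒vertexAt (low₁ {j} j<m)  =
    trans (vertexAt-level₁ (1+2*m<2*n j<m)) (cong (_, suc zero) (zigzag-odd (c ∸_) id j))
  CycleVertex⇒vertexAt mid             = vertexAt-mid
  CycleVertex⇒vertexAt (low₀ {s} s≤m)  =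
    trans (vertexAt-level₀ (*-monoʳ-≤ 2 s≤m)) (cong (_, zero) (zigzag-even (m ∸_) (3 * m +_) s))
  CycleVertex⇒vertexAt (high₀ {s} s<m) =
    trans (vertexAt-level₀ (<⇒≤ (1+2*m<2*n s<m))) (cong (_, zero) (zigzag-odd (m ∸_) (3 * m +_) s))

  someCycleVertex : ∀ {p} → p < ℓ → ∃ (CycleVertex p)
  someCycleVertex {zero} _ = _ , top
  someCycleVertex {suc q} 1+q<ℓ with <-cmp q (2 * m)
  ... | tri< q<2m _ _ with evenOrOdd q
  ...   | even j = _ , high₁ {j} (*-cancelˡ-< 2 j m q<2m)
  ...   | odd j  = _ , low₁ {j} (*-cancelˡ-< 2 j m (<-trans (n<1+n _) q<2m))
  someCycleVertex {suc q} 1+q<ℓ | tri≈ _ refl _ = _ , mid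
  someCycleVertex {suc q} 1+q<ℓ | tri> _ _ 2m<q with m≤n⇒∃[o]m+o≡n 2m<q
  ... | r , refl with evenOrOdd r
  ...   | even s = _ , low₀ {s} (*-cancelˡ-≤ 2 (level₀-offset-≤ 1+q<ℓ))
  ...   | odd s  = _ , high₀ {s} (*-cancelˡ-< 2 s m (level₀-offset-≤ 1+q<ℓ))

  cycleVertex : ∀ {p} → p < ℓ → CycleVertex p (vertexAt p)
  cycleVertex p<ℓ with someCycleVertex p<ℓ
  ... | _ , v = subst (CycleVertex _) (sym (CycleVertex⇒vertexAt v)) v

  CycleVertex-value-≤ℓ : ∀ {p v i} → CycleVertex p (v , i) → v ≤ ℓ
  CycleVertex-value-≤ℓ top             = ≤-refl
  CycleVertex-value-≤ℓ (high₁ {j} _)   = <⇒≤ (≤-<-trans (m∸n≤m c j) c<ℓ)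
  CycleVertex-value-≤ℓ (low₁ j<m)      = <⇒≤ (<-trans j<m m<ℓ)
  CycleVertex-value-≤ℓ mid             = <⇒≤ m<ℓ
  CycleVertex-value-≤ℓ (low₀ {s} _)    = ≤-trans (m∸n≤m m s) (<⇒≤ m<ℓ)
  CycleVertex-value-≤ℓ (high₀ {s} s<m) =
    ≤-trans (+-monoʳ-≤ (3 * m) (<⇒≤ s<m)) (≤-trans (≤-reflexive (+-comm (3 * m) m)) (<⇒≤ 4m<ℓ))

  vertexAt-≤ℓ : ∀ {p} → p ≤ ℓ → proj₁ (vertexAt p) ≤ ℓ
  vertexAt-≤ℓ p≤ℓ with m≤n⇒m<n∨m≡n p≤ℓ
  ... | inj₁ p<ℓ  = CycleVertex-value-≤ℓ (cycleVertex p<ℓ)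
  ... | inj₂ refl = ≤-reflexive (cong proj₁ vertexAt-ℓ)

  -- Every value is at most ℓ < N, so `mod N` only changes the type.
  toVertex : ℕ × Fin 2 → Vtx ℓ
  toVertex (v , i) = v mod N , i

  toℕ-mod : ∀ {v} → v ≤ ℓ → toℕ (v mod N) ≡ v
  toℕ-mod v≤ℓ = trans (toℕ-fromℕ< _) (m<n⇒m%n≡m (≤-<-trans v≤ℓ (m<m+n ℓ z<s)))

  pmRep-mod : ∀ {x y} → x ≤ ℓ → y ≤ ℓ → pmRep N (subMod N (toℕ (x mod N)) (toℕ (y mod N))) ≡ ∣ x - y ∣
  pmRep-mod {x} {y} x≤ℓ y≤ℓ =
    trans (cong₂ (λ a b → pmRep N (subMod N a b)) (toℕ-mod x≤ℓ) (toℕ-mod y≤ℓ)) (pmRep-subMod N x y 2d≤N)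
    where
    d≤ℓ : ∣ x - y ∣ ≤ ℓ
    d≤ℓ = ≤-trans (∣m-n∣≤m⊔n x y) (⊔-lub x≤ℓ y≤ℓ)
    2d≤N : ∣ x - y ∣ + ∣ x - y ∣ ≤ N
    2d≤N = ≤-trans (+-mono-≤ d≤ℓ d≤ℓ) (≤-reflexive (cong (ℓ +_) (sym (+-identityʳ ℓ))))

  cycle : Fin ℓ → Vtx ℓ
  cycle i = toVertex (vertexAt (toℕ i))

  edgeAt : ℕ → Kind
  edgeAt p = kind ℓ (toVertex (vertexAt p)) (toVertex (vertexAt (suc p)))

  edgeKind-cycle : ∀ i → edgeKind ℓ cycle i ≡ edgeAt (toℕ i)
  edgeKind-cycle i =
    cong (kind ℓ (cycle i)) (next-periodic (toVertex ∘ vertexAt) (cong toVertex vertexAt-ℓ) i)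

  pureKind : Fin 2 → ℕ → Kind
  pureKind zero       = pure0
  pureKind (suc zero) = pure1

  kind-level : ∀ {a b} i → kind ℓ (a , i) (b , i) ≡ pureKind i (pmRep N (subMod N (toℕ a) (toℕ b)))
  kind-level zero       = refl
  kind-level (suc zero) = refl

  edgeAt-pure : ∀ {p x y} i → p < ℓ → vertexAt p ≡ (x , i) → vertexAt (suc p) ≡ (y , i) →
    edgeAt p ≡ pureKind i ∣ x - y ∣
  edgeAt-pure {p} {x} {y} i p<ℓ vertexAt-p vertexAt-1+p = begin
    edgeAt p
      ≡⟨ cong₂ (λ u w → kind ℓ (toVertex u) (toVertex w)) vertexAt-p vertexAt-1+p ⟩
    kind ℓ (x mod N , i) (y mod N , i)
      ≡⟨ kind-level i ⟩
    pureKind i (pmRep N (subMod N (toℕ (x mod N)) (toℕ (y mod N))))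
      ≡⟨ cong (pureKind i) (pmRep-mod x≤ℓ y≤ℓ) ⟩
    pureKind i ∣ x - y ∣ ∎
    where
    x≤ℓ : x ≤ ℓ
    x≤ℓ = subst (λ v → proj₁ v ≤ ℓ) vertexAt-p (vertexAt-≤ℓ (<⇒≤ p<ℓ))
    y≤ℓ : y ≤ ℓ
    y≤ℓ = subst (λ v → proj₁ v ≤ ℓ) vertexAt-1+p (vertexAt-≤ℓ p<ℓ)

  edgeAt-first : edgeAt 0 ≡ pure1 4
  edgeAt-first =
    trans (edgeAt-pure (suc zero) z<s refl (vertexAt-level₁ 0<2m))
          (cong pure1 (n+o≡m⇒∣m-n∣≡o (trans (+-comm c 4) (cong (3 +_) 1+c≡4m))))

  edgeAt-level₁ : ∀ {q d} → suc q < 2 * m → q + d ≡ c → edgeAt (suc q) ≡ pure1 d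
  edgeAt-level₁ {q} 1+q<2m q+d≡c =
    trans (edgeAt-pure (suc zero) (<-trans 1+q<2m 2m<ℓ)
                       (vertexAt-level₁ (<-trans (n<1+n q) 1+q<2m)) (vertexAt-level₁ 1+q<2m))
          (cong pure1 (converging-gap q+d≡c))

  edgeAt-turn : edgeAt (2 * m) ≡ pure1 1
  edgeAt-turn = begin
    edgeAt (2 * m)      ≡⟨ cong edgeAt 2m≡2+2j ⟩
    edgeAt (2 + 2 * j)  ≡⟨ edgeAt-pure (suc zero) (subst (_< ℓ) 2m≡2+2j 2m<ℓ)
                             (CycleVertex⇒vertexAt (low₁ j<m))
                             (trans (cong (vertexAt ∘ suc) (sym 2m≡2+2j)) vertexAt-mid) ⟩
    pure1 ∣ j - m ∣     ≡⟨ cong pure1 (m+o≡n⇒∣m-n∣≡o j+1≡m) ⟩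
    pure1 1             ∎
    where
    j : ℕ
    j = m ∸ 1
    j+1≡m : j + 1 ≡ m
    j+1≡m = m∸n+n≡m (≤-trans (s≤s z≤n) 2≤m)
    j<m : j < m
    j<m = subst (j <_) j+1≡m (m<m+n j z<s)
    2m≡2+2j : 2 * m ≡ 2 + 2 * j
    2m≡2+2j = trans (cong (2 *_) (sym (trans (+-comm 1 j) j+1≡m))) (cong suc (+-suc j (j + 0)))

  edgeAt-cross : edgeAt (suc (2 * m)) ≡ mixed 0
  edgeAt-cross = begin
    edgeAt (suc (2 * m))
      ≡⟨ cong₂ (λ u w → kind ℓ (toVertex u) (toVertex w)) vertexAt-mid
               (trans (cong (λ x → vertexAt (2 + x)) (sym (+-identityʳ (2 * m)))) (vertexAt-level₀ z≤n)) ⟩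
    mixed (subMod N (toℕ (m mod N)) (toℕ (m mod N)))
      ≡⟨ cong mixed (trans (subMod-≤ N (≤-refl {toℕ (m mod N)})) (n∸n≡0 (toℕ (m mod N)))) ⟩
    mixed 0 ∎

  edgeAt-level₀ : ∀ {q} → q < 2 * m → edgeAt (2 + 2 * m + q) ≡ pure0 (2 * m + q)
  edgeAt-level₀ {q} q<2m =
    trans (edgeAt-pure zero (level₀-position-< (<⇒≤ q<2m)) (vertexAt-level₀ (<⇒≤ q<2m))
                       (trans (cong vertexAt (sym (+-suc (2 + 2 * m) q))) (vertexAt-level₀ q<2m)))
          (cong pure0 (diverging-gap (m + 2 * m ≡ 3 * m ∋ solve (m ∷ [])) q<2m))

  edgeAt-closing : edgeAt (2 + 2 * m + 2 * m) ≡ mixed ℓ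
  edgeAt-closing = begin
    edgeAt (2 + 2 * m + 2 * m)
      ≡⟨ cong₂ (λ u w → kind ℓ (toVertex u) (toVertex w)) (CycleVertex⇒vertexAt (low₀ {m} ≤-refl))
               (trans (cong vertexAt (suc (2 + 2 * m + 2 * m) ≡ 3 + 4 * m ∋ solve (m ∷ []))) vertexAt-ℓ) ⟩
    mixed (subMod N (toℕ ((m ∸ m) mod N)) (toℕ (ℓ mod N)))
      ≡⟨ cong mixed (cong₂ (subMod N) (trans (toℕ-mod (≤-trans (m∸n≤m m m) (<⇒≤ m<ℓ))) (n∸n≡0 m))
                                      (toℕ-mod ≤-refl)) ⟩
    mixed ℓ ∎

  data EdgeKindAt (p : ℕ) : Kind → Set where
    first   : p ≡ 0 → EdgeKindAt p (pure1 4)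
    inner₁  : ∀ {d} → p < 2 * m → d + p ≡ 4 * m → EdgeKindAt p (pure1 d)
    turn    : p ≡ 2 * m → EdgeKindAt p (pure1 1)
    cross   : p ≡ suc (2 * m) → EdgeKindAt p (mixed 0)
    inner₀  : ∀ {d} → 2 * m ≤ d → d < 4 * m → p ≡ 2 + d → EdgeKindAt p (pure0 d)
    closing : p ≡ 2 + 2 * m + 2 * m → EdgeKindAt p (mixed ℓ)

  edgeKindAt : ∀ {p} → p < ℓ → EdgeKindAt p (edgeAt p)
  edgeKindAt {zero} _ = subst (EdgeKindAt 0) (sym edgeAt-first) (first refl)
  edgeKindAt {suc q} 1+q<ℓ with <-cmp (suc q) (2 * m)
  ... | tri< 1+q<2m _ _ =
    subst (EdgeKindAt (suc q)) (sym (edgeAt-level₁ 1+q<2m (m+[n∸m]≡n q≤c))) (inner₁ 1+q<2m d+1+q≡4m)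
    where
    q≤c : q ≤ c
    q≤c = ≤-trans (<⇒≤ (<-trans (n<1+n q) 1+q<2m)) 2m≤c
    d+1+q≡4m : c ∸ q + suc q ≡ 4 * m
    d+1+q≡4m = trans (+-suc (c ∸ q) q) (trans (cong suc (m∸n+n≡m q≤c)) 1+c≡4m)
  ... | tri≈ _ 1+q≡2m _ =
    subst (EdgeKindAt (suc q)) (sym (trans (cong edgeAt 1+q≡2m) edgeAt-turn)) (turn 1+q≡2m)
  ... | tri> _ _ 2m<1+q with m≤n⇒m<n∨m≡n (≤-pred 2m<1+q)
  ...   | inj₂ refl = subst (EdgeKindAt _) (sym edgeAt-cross) (cross refl)
  ...   | inj₁ 2m<q with m≤n⇒∃[o]m+o≡n 2m<q
  ...     | r , refl with m≤n⇒m<n∨m≡n (level₀-offset-≤ 1+q<ℓ)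
  ...       | inj₁ r<2m = subst (EdgeKindAt _) (sym (edgeAt-level₀ r<2m))
                (inner₀ (m≤m+n (2 * m) r) (subst (2 * m + r <_) 2m+2m≡4m (+-monoʳ-< (2 * m) r<2m)) refl)
  ...       | inj₂ refl = subst (EdgeKindAt _) (sym edgeAt-closing) (closing refl)

  cycle-edge : ∀ i {κ} → edgeKind ℓ cycle i ≡ κ → EdgeKindAt (toℕ i) κ
  cycle-edge i e = subst (EdgeKindAt (toℕ i)) (trans (sym (edgeKind-cycle i)) e) (edgeKindAt (toℕ<n i))

  pure0-position : ∀ {p d} → EdgeKindAt p (pure0 d) → p ≡ 2 + d
  pure0-position (inner₀ _ _ p≡2+d) = p≡2+d

  d+p≡4m⇒2m<d : ∀ {p d} → p < 2 * m → d + p ≡ 4 * m → 2 * m < d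
  d+p≡4m⇒2m<d {p} {d} p<2m d+p≡4m =
    +-cancelʳ-< (2 * m) (2 * m) d (subst (_< d + 2 * m) (trans d+p≡4m (sym 2m+2m≡4m)) (+-monoʳ-< d p<2m))

  pure1-position-unique : ∀ {p p′ d} → EdgeKindAt p (pure1 d) → EdgeKindAt p′ (pure1 d) → p ≡ p′
  pure1-position-unique (first p≡0) (first p′≡0) = trans p≡0 (sym p′≡0)
  pure1-position-unique (first _) (inner₁ p′<2m 4+p′≡4m) =
    ⊥-elim (<⇒≱ (d+p≡4m⇒2m<d p′<2m 4+p′≡4m) 4≤2m)
  pure1-position-unique (inner₁ p<2m 4+p≡4m) (first _) =
    ⊥-elim (<⇒≱ (d+p≡4m⇒2m<d p<2m 4+p≡4m) 4≤2m)
  pure1-position-unique (inner₁ _ d+p≡4m) (inner₁ _ d+p′≡4m) =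
    +-cancelˡ-≡ _ _ _ (trans d+p≡4m (sym d+p′≡4m))
  pure1-position-unique (inner₁ p<2m 1+p≡4m) (turn _) =
    ⊥-elim (<⇒≱ (d+p≡4m⇒2m<d p<2m 1+p≡4m) (≤-trans (s≤s z≤n) 4≤2m))
  pure1-position-unique (turn _) (inner₁ p′<2m 1+p′≡4m) =
    ⊥-elim (<⇒≱ (d+p≡4m⇒2m<d p′<2m 1+p′≡4m) (≤-trans (s≤s z≤n) 4≤2m))
  pure1-position-unique (turn p≡2m) (turn p′≡2m) = trans p≡2m (sym p′≡2m)

  mixed-position : ∀ {p d} → EdgeKindAt p (mixed d) → p ≡ suc (2 * m) ⊎ p ≡ 2 + 2 * m + 2 * m
  mixed-position (cross p≡)   = inj₁ p≡
  mixed-position (closing p≡) = inj₂ p≡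

  1+[ℓ∸5]/2≡2m : suc ((ℓ ∸ 5) / 2) ≡ 2 * m
  1+[ℓ∸5]/2≡2m = trans (cong suc [ℓ∸5]/2≡2m∸1) (trans (+-comm 1 _) (m∸n+n≡m (≤-trans (s≤s z≤n) 4≤2m)))
    where
    [ℓ∸5]/2≡2m∸1 : (ℓ ∸ 5) / 2 ≡ 2 * m ∸ 1
    [ℓ∸5]/2≡2m∸1 = m≡n*2⇒m/2≡n
      (trans (cong (_∸ 2) (4 * m ≡ 2 * m * 2 ∋ solve (m ∷ []))) (sym (*-distribʳ-∸ 2 (2 * m) 1)))

  ≢[ℓ∸5]/2 : ∀ {d} → 2 * m ≤ d → d ≢ (ℓ ∸ 5) / 2
  ≢[ℓ∸5]/2 {d} 2m≤d = >⇒≢ (subst (_≤ d) (sym 1+[ℓ∸5]/2≡2m) 2m≤d)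

  pure0-allowed : ∀ {p d} → EdgeKindAt p (pure0 d) → d ≢ 2 × d ≢ (ℓ ∸ 5) / 2 × d ≢ ℓ
  pure0-allowed (inner₀ 2m≤d d<4m _) =
    >⇒≢ (≤-trans (s≤s (s≤s (s≤s z≤n))) (≤-trans 4≤2m 2m≤d)) , ≢[ℓ∸5]/2 2m≤d , <⇒≢ (<-trans d<4m 4m<ℓ)

  pure1-allowed : ∀ {p d} → EdgeKindAt p (pure1 d) → d ≢ (ℓ ∸ 5) / 2 × d ≢ ℓ
  pure1-allowed (first _) =
    (λ 4≡h → even≢odd m 2 (trans (sym 1+[ℓ∸5]/2≡2m) (cong suc (sym 4≡h)))) ,
    <⇒≢ (≤-<-trans 4≤2m 2m<ℓ)
  pure1-allowed {p} {d} (inner₁ p<2m d+p≡4m) =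
    ≢[ℓ∸5]/2 (<⇒≤ (d+p≡4m⇒2m<d p<2m d+p≡4m)) ,
    <⇒≢ (≤-<-trans (subst (d ≤_) d+p≡4m (m≤m+n d p)) 4m<ℓ)
  pure1-allowed (turn _) =
    (λ 1≡h → <⇒≢ (≤-trans (s≤s (s≤s (s≤s z≤n))) 4≤2m) (trans (cong suc 1≡h) 1+[ℓ∸5]/2≡2m)) ,
    λ ()

  is0pure-before-level₀ : ∀ {p κ} → EdgeKindAt p κ → p < 2 + 2 * m → is0pure κ ≡ false
  is0pure-before-level₀ (first _)            _  = refl
  is0pure-before-level₀ (inner₁ _ _)         _  = refl
  is0pure-before-level₀ (turn _)             _  = refl
  is0pure-before-level₀ (cross _)            _  = refl
  is0pure-before-level₀ (inner₀ 2m≤d _ refl) p< = ⊥-elim (<⇒≱ p< (s≤s (s≤s 2m≤d)))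
  is0pure-before-level₀ (closing _)          _  = refl

  is1pure-within-level₁ : ∀ {p κ} → EdgeKindAt p κ → p < suc (2 * m) → is1pure κ ≡ true
  is1pure-within-level₁ (first _)            _  = refl
  is1pure-within-level₁ (inner₁ _ _)         _  = refl
  is1pure-within-level₁ (turn _)             _  = refl
  is1pure-within-level₁ (cross refl)         p< = ⊥-elim (<-irrefl refl p<)
  is1pure-within-level₁ (inner₀ 2m≤d _ refl) p< = ⊥-elim (<⇒≱ p< (m≤n⇒m≤1+n (s≤s 2m≤d)))
  is1pure-within-level₁ (closing refl)       p< =
    ⊥-elim (<⇒≱ p< (≤-trans (n≤1+n _) (m≤m+n (2 + 2 * m) (2 * m))))

  is1pure-after-level₁ : ∀ {p κ} → EdgeKindAt p κ → 2 * m < p → is1pure κ ≡ false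
  is1pure-after-level₁ (first refl)    ()
  is1pure-after-level₁ (inner₁ p<2m _) 2m<p = ⊥-elim (<-asym p<2m 2m<p)
  is1pure-after-level₁ (turn refl)     2m<p = ⊥-elim (<-irrefl refl 2m<p)
  is1pure-after-level₁ (cross _)       _    = refl
  is1pure-after-level₁ (inner₀ _ _ _)  _    = refl
  is1pure-after-level₁ (closing _)     _    = refl

  cycle-pure0-count : countF {ℓ} (λ i → is0pure (edgeKind ℓ cycle i)) ≡ (ℓ ∸ 3) / 2
  cycle-pure0-count = begin
    countF (λ i → is0pure (edgeKind ℓ cycle i))
      ≡⟨ countF-cong (cong is0pure ∘ edgeKind-cycle) ⟩
    count ℓ (is0pure ∘ edgeAt)
      ≡⟨ cong (λ n → count n (is0pure ∘ edgeAt)) (3 + 4 * m ≡ (2 + 2 * m) + suc (2 * m) ∋ solve (m ∷ [])) ⟩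
    count ((2 + 2 * m) + suc (2 * m)) (is0pure ∘ edgeAt)
      ≡⟨ count-+ (2 + 2 * m) (is0pure ∘ edgeAt) ⟩
    count (2 + 2 * m) (is0pure ∘ edgeAt) + count (suc (2 * m)) level₀-edge
      ≡⟨ cong₂ _+_ (count-false (λ p< → is0pure-before-level₀ (edgeKindAt (<-trans p< 2+2m<ℓ)) p<))
                   (count-snoc (2 * m) level₀-edge) ⟩
    count (2 * m) level₀-edge + bit (level₀-edge (2 * m))
      ≡⟨ cong₂ _+_ (count-true (λ q<2m → cong is0pure (edgeAt-level₀ q<2m)))
                   (cong (bit ∘ is0pure) edgeAt-closing) ⟩
    2 * m + 0
      ≡⟨ +-identityʳ (2 * m) ⟩
    2 * m
      ≡⟨ m≡n*2⇒m/2≡n (4 * m ≡ 2 * m * 2 ∋ solve (m ∷ [])) ⟨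
    (ℓ ∸ 3) / 2 ∎
    where
    level₀-edge : ℕ → Bool
    level₀-edge q = is0pure (edgeAt (2 + 2 * m + q))
    2+2m<ℓ : 2 + 2 * m < ℓ
    2+2m<ℓ = m+o≡n⇒m≤n (2 * m) (suc (2 + 2 * m) + 2 * m ≡ 3 + 4 * m ∋ solve (m ∷ []))

  cycle-pure1-count : countF {ℓ} (λ i → is1pure (edgeKind ℓ cycle i)) ≡ (ℓ ∸ 1) / 2
  cycle-pure1-count = begin
    countF (λ i → is1pure (edgeKind ℓ cycle i))
      ≡⟨ countF-cong (cong is1pure ∘ edgeKind-cycle) ⟩
    count ℓ (is1pure ∘ edgeAt)
      ≡⟨ cong (λ n → count n (is1pure ∘ edgeAt)) ℓ≡ ⟩
    count (suc (2 * m) + (2 + 2 * m)) (is1pure ∘ edgeAt)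
      ≡⟨ count-+ (suc (2 * m)) (is1pure ∘ edgeAt) ⟩
    count (suc (2 * m)) (is1pure ∘ edgeAt) + count (2 + 2 * m) (λ q → is1pure (edgeAt (suc (2 * m) + q)))
      ≡⟨ cong₂ _+_ (count-true (λ p< → is1pure-within-level₁ (edgeKindAt (≤-<-trans (≤-pred p<) 2m<ℓ)) p<))
                   (count-false (λ {q} q< → is1pure-after-level₁ (edgeKindAt (position-< q<))
                                                                 (s≤s (m≤m+n (2 * m) q)))) ⟩
    suc (2 * m) + 0
      ≡⟨ +-identityʳ (suc (2 * m)) ⟩
    suc (2 * m)
      ≡⟨ [ℓ∸1]/2≡1+2m ⟨
    (ℓ ∸ 1) / 2 ∎
    where
    ℓ≡ : ℓ ≡ suc (2 * m) + (2 + 2 * m)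
    ℓ≡ = 3 + 4 * m ≡ suc (2 * m) + (2 + 2 * m) ∋ solve (m ∷ [])
    position-< : ∀ {q} → q < 2 + 2 * m → suc (2 * m) + q < ℓ
    position-< {q} q< = subst (suc (2 * m) + q <_) (sym ℓ≡) (+-monoʳ-< (suc (2 * m)) q<)

  cycle-pure0-distinct : ∀ i j d → edgeKind ℓ cycle i ≡ pure0 d → edgeKind ℓ cycle j ≡ pure0 d → i ≡ j
  cycle-pure0-distinct i j d eᵢ eⱼ =
    toℕ-injective (trans (pure0-position (cycle-edge i eᵢ)) (sym (pure0-position (cycle-edge j eⱼ))))

  cycle-pure1-distinct : ∀ i j d → edgeKind ℓ cycle i ≡ pure1 d → edgeKind ℓ cycle j ≡ pure1 d → i ≡ j
  cycle-pure1-distinct i j d eᵢ eⱼ =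
    toℕ-injective (pure1-position-unique (cycle-edge i eᵢ) (cycle-edge j eⱼ))

  cycle-pure0-allowed : ∀ i d → edgeKind ℓ cycle i ≡ pure0 d → d ≢ 2 × d ≢ (ℓ ∸ 5) / 2 × d ≢ ℓ
  cycle-pure0-allowed i d e = pure0-allowed (cycle-edge i e)

  cycle-pure1-allowed : ∀ i d → edgeKind ℓ cycle i ≡ pure1 d → d ≢ (ℓ ∸ 5) / 2 × d ≢ ℓ
  cycle-pure1-allowed i d e = pure1-allowed (cycle-edge i e)

  cycle-mixed : ∃[ i ] ∃[ j ] (edgeKind ℓ cycle i ≡ mixed 0 × edgeKind ℓ cycle j ≡ mixed ℓ
                  × (∀ k d → edgeKind ℓ cycle k ≡ mixed d → (k ≡ i) ⊎ (k ≡ j)))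
  cycle-mixed =
    fromℕ< 1+2m<ℓ , fromℕ< closing<ℓ , at 1+2m<ℓ edgeAt-cross , at closing<ℓ edgeAt-closing ,
    λ k d e → ⊎-map (is-at 1+2m<ℓ) (is-at closing<ℓ) (mixed-position (cycle-edge k e))
    where
    closing<ℓ : 2 + 2 * m + 2 * m < ℓ
    closing<ℓ = level₀-position-< ≤-refl
    at : ∀ {p κ} (p<ℓ : p < ℓ) → edgeAt p ≡ κ → edgeKind ℓ cycle (fromℕ< p<ℓ) ≡ κ
    at p<ℓ e = trans (edgeKind-cycle _) (trans (cong edgeAt (toℕ-fromℕ< p<ℓ)) e)
    is-at : ∀ {p} (p<ℓ : p < ℓ) {k : Fin ℓ} → toℕ k ≡ p → k ≡ fromℕ< p<ℓ
    is-at p<ℓ k≡p = toℕ-injective (trans k≡p (sym (toℕ-fromℕ< p<ℓ)))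

  positionOf : ℕ × Fin 2 → ℕ
  positionOf (v , zero)     =
    if v <ᵇ suc m then 2 + 2 * m + 2 * (m ∸ v) else 2 + 2 * m + suc (2 * (v ∸ 3 * m))
  positionOf (v , suc zero) =
    if v <ᵇ m then 2 + 2 * v
    else if v <ᵇ suc m then suc (2 * m)
    else if v <ᵇ ℓ then suc (2 * (c ∸ v))
    else 0

  positionOf-correct : ∀ {p v} → CycleVertex p v → positionOf v ≡ p
  positionOf-correct top =
    trans (if-false (<ᵇ-false (<⇒≤ m<ℓ)))
          (trans (if-false (<ᵇ-false m<ℓ)) (if-false (<ᵇ-false (≤-refl {ℓ}))))
  positionOf-correct (high₁ {j} j<m) =
    trans (if-false (<ᵇ-false (<⇒≤ m<c∸j))) (trans (if-false (<ᵇ-false m<c∸j))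
      (trans (if-true (<ᵇ-true (≤-<-trans (m∸n≤m c j) c<ℓ))) (cong (λ x → suc (2 * x)) (m∸[m∸n]≡n j≤c))))
    where
    j≤c : j ≤ c
    j≤c = ≤-trans (<⇒≤ j<m) (≤-trans (m≤m+n m (m + 0)) 2m≤c)
    m<c∸j : m < c ∸ j
    m<c∸j = m+n≤o⇒m≤o∸n (suc m)
      (≤-trans (subst (_≤ 2 * m) (+-suc m j) (+-monoʳ-≤ m (≤-trans j<m (m≤m+n m 0)))) 2m≤c)
  positionOf-correct (low₁ j<m) = if-true (<ᵇ-true j<m)
  positionOf-correct mid = trans (if-false (<ᵇ-false (≤-refl {m}))) (if-true (<ᵇ-true (n<1+n m)))
  positionOf-correct (low₀ {s} s≤m) =
    trans (if-true (<ᵇ-true (s≤s (m∸n≤m m s)))) (cong (λ x → 2 + 2 * m + 2 * x) (m∸[m∸n]≡n s≤m))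
  positionOf-correct (high₀ {s} _) =
    trans (if-false (<ᵇ-false 1+m≤3m+s)) (cong (λ x → 2 + 2 * m + suc (2 * x)) (m+n∸m≡n (3 * m) s))
    where
    1+m≤3m+s : suc m ≤ 3 * m + s
    1+m≤3m+s = ≤-trans (≤-trans (≤-reflexive (+-comm 1 m)) (+-monoʳ-≤ m 0<2m)) (m≤m+n (3 * m) s)

  cycle-injective : Injective _≡_ _≡_ cycle
  cycle-injective {i} {j} cycle-i≡cycle-j = toℕ-injective (begin
    toℕ i                         ≡⟨ positionOf-correct (cycleVertex (toℕ<n i)) ⟨
    positionOf (vertexAt (toℕ i)) ≡⟨ cong positionOf (cong₂ _,_ same-value (cong proj₂ cycle-i≡cycle-j)) ⟩
    positionOf (vertexAt (toℕ j)) ≡⟨ positionOf-correct (cycleVertex (toℕ<n j)) ⟩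
    toℕ j                         ∎)
    where
    same-value : proj₁ (vertexAt (toℕ i)) ≡ proj₁ (vertexAt (toℕ j))
    same-value = trans (sym (toℕ-mod (vertexAt-≤ℓ (<⇒≤ (toℕ<n i)))))
                       (trans (cong (toℕ ∘ proj₁) cycle-i≡cycle-j) (toℕ-mod (vertexAt-≤ℓ (<⇒≤ (toℕ<n j)))))

  1+j+s≡m⇒c∸j≡3m+s : ∀ {j s} → suc (j + s) ≡ m → c ∸ j ≡ 3 * m + s
  1+j+s≡m⇒c∸j≡3m+s {j} {s} 1+j+s≡m = trans (cong (_∸ j) c≡) (m+n∸m≡n j (3 * m + s))
    where
    regroup : ∀ x j s → x + suc (j + s) ≡ suc (j + (x + s))
    regroup = solve-∀
    c≡ : c ≡ j + (3 * m + s)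
    c≡ = suc-injective (begin
      suc c                 ≡⟨ 1+c≡4m ⟩
      4 * m                 ≡⟨ +-comm m (3 * m) ⟩
      3 * m + m             ≡⟨ cong (3 * m +_) 1+j+s≡m ⟨
      3 * m + suc (j + s)   ≡⟨ regroup (3 * m) j s ⟩
      suc (j + (3 * m + s)) ∎)

  level₁-partner : ∀ {p v} → CycleVertex p (v , zero) → ∃[ p′ ] (p′ < ℓ × CycleVertex p′ (v , suc zero))
  level₁-partner (low₀ {zero} _)    = suc (2 * m) , 1+2m<ℓ , mid
  level₁-partner (low₀ {suc s} s<m) = 2 + 2 * j , <-≤-trans (s≤s (1+2*m<2*n j<m)) 2m<ℓ , low₁ j<m
    where
    j : ℕ
    j = m ∸ suc s
    j<m : j < m
    j<m = ∸-monoʳ-< z<s s<m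
  level₁-partner (high₀ {s} s<m)    =
    suc (2 * j) , <-trans (1+2*m<2*n j<m) 2m<ℓ ,
    subst (λ v → CycleVertex (suc (2 * j)) (v , suc zero)) (1+j+s≡m⇒c∸j≡3m+s 1+j+s≡m) (high₁ j<m)
    where
    j : ℕ
    j = m ∸ suc s
    j<m : j < m
    j<m = ∸-monoʳ-< z<s s<m
    1+j+s≡m : suc (j + s) ≡ m
    1+j+s≡m = trans (sym (+-suc j s)) (m∸n+n≡m s<m)

  cycle-level₀⊆level₁ : ∀ k a → cycle k ≡ (a , zero) → ∃[ k′ ] cycle k′ ≡ (a , suc zero)
  cycle-level₀⊆level₁ k a cycle-k≡a₀
    with level₁-partner (subst (CycleVertex (toℕ k))
                               (cong (proj₁ (vertexAt (toℕ k)) ,_) (cong proj₂ cycle-k≡a₀))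
                               (cycleVertex (toℕ<n k)))
  ... | p′ , p′<ℓ , partner = fromℕ< p′<ℓ , (begin
    cycle (fromℕ< p′<ℓ)                         ≡⟨ cong (toVertex ∘ vertexAt) (toℕ-fromℕ< p′<ℓ) ⟩
    toVertex (vertexAt p′)                      ≡⟨ cong toVertex (CycleVertex⇒vertexAt partner) ⟩
    (proj₁ (vertexAt (toℕ k)) mod N , suc zero) ≡⟨ cong (_, suc zero) (cong proj₁ cycle-k≡a₀) ⟩
    (a , suc zero)                              ∎)

  count-vertexAt : ∀ (h : ℕ × Fin 2 → Bool) → count ℓ (h ∘ vertexAt) ≡
    bit (h (ℓ , suc zero)) + (count (2 * m) (λ q → h (level₁ q , suc zero))
                              + (bit (h (m , suc zero)) + count (suc (2 * m)) (λ q → h (level₀ q , zero))))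
  count-vertexAt h = begin
    count ℓ (h ∘ vertexAt)
      ≡⟨ cong (λ n → count n (h ∘ vertexAt)) (3 + 4 * m ≡ 1 + (2 * m + suc (suc (2 * m))) ∋ solve (m ∷ [])) ⟩
    count (1 + (2 * m + suc (suc (2 * m)))) (h ∘ vertexAt)
      ≡⟨ cong (bit (h (ℓ , suc zero)) +_) (count-+ (2 * m) (λ q → h (vertexAt (suc q)))) ⟩
    bit (h (ℓ , suc zero)) + (count (2 * m) (λ q → h (vertexAt (suc q)))
                              + (bit (h (vertexAt (suc (2 * m + 0))))
                                 + count (suc (2 * m)) (λ q → h (vertexAt (suc (2 * m + suc q))))))
      ≡⟨ cong (bit (h (ℓ , suc zero)) +_) (cong₂ _+_ level₁-part (cong₂ _+_ mid-part level₀-part)) ⟩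
    bit (h (ℓ , suc zero)) + (count (2 * m) (λ q → h (level₁ q , suc zero))
                              + (bit (h (m , suc zero)) + count (suc (2 * m)) (λ q → h (level₀ q , zero)))) ∎
    where
    level₁-part : count (2 * m) (λ q → h (vertexAt (suc q))) ≡ count (2 * m) (λ q → h (level₁ q , suc zero))
    level₁-part = count-cong (λ q<2m → cong h (vertexAt-level₁ q<2m))
    mid-part : bit (h (vertexAt (suc (2 * m + 0)))) ≡ bit (h (m , suc zero))
    mid-part = cong (bit ∘ h) (trans (cong (vertexAt ∘ suc) (+-identityʳ (2 * m))) vertexAt-mid)
    level₀-part : count (suc (2 * m)) (λ q → h (vertexAt (suc (2 * m + suc q)))) ≡
                  count (suc (2 * m)) (λ q → h (level₀ q , zero))
    level₀-part = count-cong (λ {q} q≤2m → cong h (trans (cong (vertexAt ∘ suc) (+-suc (2 * m) q))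
                                                           (vertexAt-level₀ (≤-pred q≤2m))))

  translate : Fin N → ℕ → ℕ
  translate t v = shiftVal ℓ (toℕ (v mod N)) (toℕ t)

  -- `redCount ℓ cycle t` unfolds to `count ℓ (colour (translate t) ∘ vertexAt)`.
  colour : (ℕ → ℕ) → ℕ × Fin 2 → Bool
  colour σ (v , i) = isRed ℓ (σ v) i

  colour-count : ∀ σ → count ℓ (colour σ ∘ vertexAt) ≡ bit (not (σ ℓ <ᵇ ℓ)) + suc (2 * m)
  colour-count σ = begin
    count ℓ (colour σ ∘ vertexAt)
      ≡⟨ count-vertexAt (colour σ) ⟩
    Top + (count (2 * m) (λ q → not (ρ (level₁ q))) + (X′ + count (suc (2 * m)) (λ q → ρ (level₀ q))))
      ≡⟨ cong₂ (λ a b → Top + (a + (X′ + (X + b))))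
               (count-zigzag m (not ∘ ρ) (c ∸_) id) (count-zigzag m ρ (3 * m +_) (λ s → m ∸ suc s)) ⟩
    Top + ((H′ + L′) + (X′ + (X + (count m (λ s → ρ (3 * m + s)) + count m (λ s → ρ (m ∸ suc s))))))
      ≡⟨ cong₂ (λ a b → Top + ((H′ + L′) + (X′ + (X + (a + b))))) high₀≡high₁ (count-reverse m ρ) ⟩
    Top + ((H′ + L′) + (X′ + (X + (H + L))))
      ≡⟨ rearrange Top H′ L′ X′ X H L ⟩
    Top + ((H′ + H) + (L′ + L) + ((X′ + 0) + (X + 0)))
      ≡⟨ cong (Top +_) (cong₂ _+_ (cong₂ _+_ (count-complement m (ρ ∘ (c ∸_))) (count-complement m ρ))
                                (count-complement 1 (λ _ → ρ m))) ⟩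
    Top + (m + m + 1)
      ≡⟨ cong (Top +_) (m + m + 1 ≡ suc (2 * m) ∋ solve (m ∷ [])) ⟩
    Top + suc (2 * m) ∎
    where
    ρ : ℕ → Bool
    ρ v = σ v <ᵇ ℓ
    -- Red counts among the values ℓ, m, c ∸ j and j; a prime marks level 1, coloured by not ∘ ρ.
    Top X′ X H′ H L′ L : ℕ
    Top = bit (not (ρ ℓ))
    X′  = bit (not (ρ m))
    X   = bit (ρ m)
    H′  = count m (λ j → not (ρ (c ∸ j)))
    H   = count m (λ j → ρ (c ∸ j))
    L′  = count m (λ j → not (ρ j))
    L   = count m ρ
    high₀≡high₁ : count m (λ s → ρ (3 * m + s)) ≡ H
    high₀≡high₁ = trans (sym (count-reverse m (λ s → ρ (3 * m + s))))
      (sym (count-cong (λ {j} j<m → cong ρ (1+j+s≡m⇒c∸j≡3m+s {j} {m ∸ suc j} (m+[n∸m]≡n j<m)))))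
    rearrange : ∀ t h′ l′ x′ x h l →
      t + ((h′ + l′) + (x′ + (x + (h + l)))) ≡ t + ((h′ + h) + (l′ + l) + ((x′ + 0) + (x + 0)))
    rearrange = solve-∀

  cycle-equitable : ∀ t → (redCount ℓ cycle t ≡ (ℓ ∸ 1) / 2) ⊎ (redCount ℓ cycle t ≡ (ℓ + 1) / 2)
  cycle-equitable t with translate t ℓ <ᵇ ℓ | colour-count (translate t)
  ... | true  | red≡ = inj₁ (trans red≡ (sym [ℓ∸1]/2≡1+2m))
  ... | false | red≡ = inj₂ (trans red≡ (sym [ℓ+1]/2≡2+2m))
    where
    [ℓ+1]/2≡2+2m : (ℓ + 1) / 2 ≡ 2 + 2 * m
    [ℓ+1]/2≡2+2m = m≡n*2⇒m/2≡n ((3 + 4 * m) + 1 ≡ (2 + 2 * m) * 2 ∋ solve (m ∷ []))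

n%8≡3⇒n≡3+4m : ∀ {n} → n % 8 ≡ 3 → 11 ≤ n → ∃[ m ] (2 ≤ m × n ≡ 3 + 4 * m)
n%8≡3⇒n≡3+4m {n} n%8≡3 11≤n with n / 8 | trans (m≡m%n+[m/n]*n n 8) (cong (_+ (n / 8) * 8) n%8≡3)
... | zero  | n≡3        = ⊥-elim (<⇒≱ (s≤s (s≤s (s≤s (s≤s z≤n)))) (subst (11 ≤_) n≡3 11≤n))
... | suc q | n≡3+[1+q]8 =
  2 + 2 * q , m≤m+n 2 (2 * q) , trans n≡3+[1+q]8 (3 + suc q * 8 ≡ 3 + 4 * (2 + 2 * q) ∋ solve (q ∷ []))

lemma4 : (ℓ : ℕ) → ℓ % 8 ≡ 3 → 11 ≤ ℓ →
    Σ[ C ∈ (Fin ℓ → Vtx ℓ) ]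
      ( Injective _≡_ _≡_ C
      × countF {ℓ} (λ i → is0pure (edgeKind ℓ C i)) ≡ (ℓ ∸ 3) / 2
      × countF {ℓ} (λ i → is1pure (edgeKind ℓ C i)) ≡ (ℓ ∸ 1) / 2
      × (∀ i j d → edgeKind ℓ C i ≡ pure0 d → edgeKind ℓ C j ≡ pure0 d → i ≡ j)
      × (∀ i j d → edgeKind ℓ C i ≡ pure1 d → edgeKind ℓ C j ≡ pure1 d → i ≡ j)
      × (∃[ i ] ∃[ j ] (edgeKind ℓ C i ≡ mixed 0 × edgeKind ℓ C j ≡ mixed ℓ
          × (∀ k d → edgeKind ℓ C k ≡ mixed d → (k ≡ i) ⊎ (k ≡ j))))
      × (∀ i d → edgeKind ℓ C i ≡ pure0 d → d ≢ 2 × d ≢ (ℓ ∸ 5) / 2 × d ≢ ℓ)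
      × (∀ i d → edgeKind ℓ C i ≡ pure1 d → d ≢ (ℓ ∸ 5) / 2 × d ≢ ℓ)
      × (∀ k a → C k ≡ (a , zero) → ∃[ k′ ] C k′ ≡ (a , suc zero))
      × (∀ (t : Fin (2 * ℓ)) →
           (redCount ℓ C t ≡ (ℓ ∸ 1) / 2) ⊎ (redCount ℓ C t ≡ (ℓ + 1) / 2)) )
lemma4 ℓ ℓ%8≡3 11≤ℓ with n%8≡3⇒n≡3+4m ℓ%8≡3 11≤ℓ
... | m , 2≤m , refl =
  cycle , cycle-injective , cycle-pure0-count , cycle-pure1-count ,
  cycle-pure0-distinct , cycle-pure1-distinct , cycle-mixed , cycle-pure0-allowed , cycle-pure1-allowed ,
  cycle-level₀⊆level₁ , cycle-equitable
  where open Cycle m 2≤m
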